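{- Let $f\in\mathbb{Q}[x_1,\dots,x_n]$ be a form of degree $d\ge 2$ with $h=h(f)$, and let $1\le M\le h$. Suppose $$f=(x_1+\ell_1)v_1+\dots+(x_M+\ell_M)v_M+u_{M+1}v_{M+1}+\dots+u_hv_h,$$ where each $\ell_i$ ($1\le i\le M$) is a linear form in $\mathbb{Q}[x_{M+1},\dots,x_n]$, and all $u_{i'}$ ($M+1\le i'\le h$) and $v_j$ ($1\le j\le h$) are rational forms of positive degree. Define $g_M\in\mathbb{Q}[x_1,\dots,x_n]$ by $$f(x_1,\dots,x_n)=g_M(x_1,\dots,x_n)+f(-\ell_1,\dots,-\ell_M,x_{M+1},\dots,x_n).$$ Then $$h(g_M)\ge M\qquad\text{and}\qquad h\big(f(-\ell_1,\dots,-\ell_M,x_{M+1},\dots,x_n)\big)=h-M.$$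
   Context: $h$-invariant: for a form $f\in\mathbb{Q}[x_1,\dots,x_n]$ of degree at least $2$, $h(f)$ is the least positive integer $h$ such that $f=U_1V_1+\dots+U_hV_h$ identically with all $U_i,V_i$ forms in $\mathbb{Q}[x_1,\dots,x_n]$ of degree at least $1$; $h(0)=0$. -}

module Defs where

open import Data.Nat as ℕ using (ℕ; zero; suc; _≤_; _<_; _<?_)
open import Data.Fin using (Fin; zero; suc; toℕ; fromℕ<; inject≤)
open import Data.Vec using (Vec; []; _∷_; zipWith; replicate; lookup; updateAt)
import Data.Vec as V
open import Data.Vec.Properties using (≡-dec)
open import Data.List using (List; []; _∷_; _++_; map; concatMap; foldr)
open import Data.Product using (Σ; _×_; _,_; proj₁; proj₂)
open import Data.Rational as ℚ using (ℚ; 0ℚ; 1ℚ)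
open import Relation.Binary.PropositionalEquality using (_≡_; _≢_)
open import Relation.Nullary using (¬_; yes; no)

-- Polynomials in n variables over ℚ, as finite lists of terms
-- (exponent vector, coefficient).  Two lists denote the same polynomial
-- iff all their (collected) coefficients agree: see _≈_.
Mono : ℕ → Set
Mono n = Vec ℕ n

Poly : ℕ → Set
Poly n = List (Mono n × ℚ)

coeff : ∀ {n} → Poly n → Mono n → ℚ
coeff [] α = 0ℚ
coeff ((β , c) ∷ p) α with ≡-dec ℕ._≟_ β α
... | yes _ = c ℚ.+ coeff p α
... | no _  = coeff p α

infix 4 _≈_
_≈_ : ∀ {n} → Poly n → Poly n → Set
p ≈ q = ∀ α → coeff p α ≡ coeff q α

0P : ∀ {n} → Poly n
0P = []

1P : ∀ {n} → Poly n
1P {n} = (replicate n 0 , 1ℚ) ∷ []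

X : ∀ {n} → Fin n → Poly n
X {n} j = (updateAt (replicate n 0) j (λ _ → 1) , 1ℚ) ∷ []

infixl 6 _+P_
infixl 7 _*P_

_+P_ : ∀ {n} → Poly n → Poly n → Poly n
p +P q = p ++ q

-P_ : ∀ {n} → Poly n → Poly n
-P p = map (λ t → proj₁ t , ℚ.- proj₂ t) p

_*P_ : ∀ {n} → Poly n → Poly n → Poly n
p *P q = concatMap (λ s → map (λ t → zipWith ℕ._+_ (proj₁ s) (proj₁ t) , proj₂ s ℚ.* proj₂ t) q) p

_^P_ : ∀ {n} → Poly n → ℕ → Poly n
p ^P zero = 1P
p ^P suc k = p *P (p ^P k)

scaleP : ∀ {n} → ℚ → Poly n → Poly n
scaleP c p = map (λ t → proj₁ t , c ℚ.* proj₂ t) p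

sumP : ∀ {n k} → (Fin k → Poly n) → Poly n
sumP {k = zero} F = 0P
sumP {k = suc k} F = F zero +P sumP (λ i → F (suc i))

subst : ∀ {n m} → (Fin n → Poly m) → Poly n → Poly m
subst σ p = foldr (λ t acc → scaleP (proj₂ t) (monoEval (proj₁ t)) +P acc) 0P p
  where
  monoEval : Mono _ → Poly _
  monoEval α = V.foldr _ (λ q acc → q *P acc) 1P (V.zipWith _^P_ (V.tabulate σ) α)

deg : ∀ {n} → Mono n → ℕ
deg = V.sum

-- p is homogeneous of degree e (the zero polynomial counts as homogeneous)
Homog : ∀ {n} → ℕ → Poly n → Set
Homog e p = ∀ α → coeff p α ≢ 0ℚ → deg α ≡ e

NonZeroP : ∀ {n} → Poly n → Set
NonZeroP p = Σ _ λ α → coeff p α ≢ 0ℚ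

PosForm : ∀ {n} → Poly n → Set
PosForm p = Σ ℕ λ e → 1 ≤ e × Homog e p × NonZeroP p

-- p only involves the variables x_j with j ≥ M (0-indexed)
OnlyVarsFrom : ∀ {n} → ℕ → Poly n → Set
OnlyVarsFrom M p = ∀ α → coeff p α ≢ 0ℚ → ∀ j → toℕ j < M → lookup α j ≡ 0

HasDecomp : ∀ {n} → Poly n → ℕ → Set
HasDecomp {n} f k =
  Σ (Fin k → Poly n) λ U → Σ (Fin k → Poly n) λ W →
    (∀ i → PosForm (U i)) × (∀ i → PosForm (W i)) × (f ≈ sumP (λ i → U i *P W i))

-- h(f) = h : h is the least such k  (h(0) = 0 via the empty sum)
HInv : ∀ {n} → Poly n → ℕ → Set
HInv f h = HasDecomp f h × (∀ k → k < h → ¬ HasDecomp f k)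

σℓ : ∀ {n M} → M ≤ n → (Fin M → Poly n) → Fin n → Poly n
σℓ {M = M} M≤n ℓ j with toℕ j <? M
... | yes j<M = -P (ℓ (fromℕ< j<M))
... | no _    = X j

{-# OPTIONS --safe #-}
module Submission where

open import Defs
open import Data.Nat as ℕ using (ℕ; zero; suc; _≤_; _<_; _∸_; z≤n; s≤s; _<?_)
import Data.Nat.Properties as ℕP
open import Data.Fin using (Fin; zero; suc; toℕ; fromℕ<; inject≤; splitAt)
import Data.Fin.Properties as FinP
open import Data.Product using (_×_; Σ; _,_; proj₁; proj₂)
open import Data.Sum using (_⊎_; inj₁; inj₂)
open import Data.Empty using (⊥-elim)
open import Function using (_∘_)
open import Data.List using ([]; _∷_; _++_; map; foldr; length)
import Data.List.Properties as ListP
open import Data.List.Relation.Unary.All using (All; []; _∷_)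
import Data.List.Relation.Unary.All.Properties as AllP
open import Data.List.Relation.Unary.Any as Any using (Any; here; there)
open import Data.Maybe using (Maybe; just; nothing)
open import Data.Vec as Vec using (Vec; []; _∷_; lookup)
open import Data.Vec.Properties as VecP using (≡-dec)
open import Data.Vec.Functional using (Vector; head; tail) renaming (_∷_ to _◂_; _++_ to _⧺_)
open import Data.Rational as ℚ using (ℚ; 0ℚ; 1ℚ)
import Data.Rational.Properties as ℚP
open import Relation.Nullary using (¬_; yes; no; Dec)
open import Relation.Nullary.Decidable using (¬?; _→-dec_)
open import Relation.Binary.PropositionalEquality hiding (subst)
import Relation.Binary.PropositionalEquality as Eq
import Relation.Binary.Reasoning.Setoid as SetoidReasoning
open import Algebra.Bundles using (CommutativeRing; CommutativeSemigroup)
open import Algebra.Bundles.Raw using (RawRing)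
import Algebra.Properties.CommutativeSemigroup as CommSemigroupProperties
open import Algebra.Solver.Ring.AlmostCommutativeRing
  using (AlmostCommutativeRing; fromCommutativeRing; _-Raw-AlmostCommutative⟶_)
import Algebra.Solver.Ring as RingSolver
open import Level using (0ℓ)

-- Let σ substitute -ℓ_i for x_i (i < M).  As ℓ_i only involves x_M, …, x_{n-1}, σ fixes ℓ_i
-- and so kills the generators x_i + ℓ_i; applied to the given decomposition of f this shows
-- h(σ f) ≤ h - M.  On the other hand x_i ≡ σ x_i modulo the ideal (x_1 + ℓ_1, …, x_M + ℓ_M),
-- hence every monomial of degree d is congruent to its image under σ with homogeneous
-- cofactors of degree d - 1 ≥ 1, and g = f - σ f = Σ (x_i + ℓ_i) Q_i gives h(g) ≤ M.  Since
-- concatenating decompositions of g and σ f decomposes f, h ≤ h(g) + h(σ f), which forces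
-- both h(g) ≥ M and h(σ f) = h - M.

-- A record around _≈_: as _≈_ unfolds to a Π-type, unification could not recover the polynomials.
infix 4 _≋_
record _≋_ {n} (p q : Poly n) : Set where
  constructor mk
  field get : p ≈ q
open _≋_

≈⇒≋ : ∀ {n} (p q : Poly n) → p ≈ q → p ≋ q
≈⇒≋ p q = mk

≋-refl : ∀ {n} {p : Poly n} → p ≋ p
≋-refl = mk λ α → refl

≋-sym : ∀ {n} {p q : Poly n} → p ≋ q → q ≋ p
≋-sym (mk e) = mk λ α → sym (e α)

≋-trans : ∀ {n} {p q r : Poly n} → p ≋ q → q ≋ r → p ≋ r
≋-trans (mk e) (mk f) = mk λ α → trans (e α) (f α)

≡⇒≋ : ∀ {n} {p q : Poly n} → p ≡ q → p ≋ q
≡⇒≋ refl = ≋-refl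

ℚ-+-commutativeSemigroup : CommutativeSemigroup 0ℓ 0ℓ
ℚ-+-commutativeSemigroup = CommutativeRing.+-commutativeSemigroup ℚP.+-*-commutativeRing

coeff-++ : ∀ {n} (p q : Poly n) α → coeff (p ++ q) α ≡ coeff p α ℚ.+ coeff q α
coeff-++ [] q α = sym (ℚP.+-identityˡ _)
coeff-++ ((β , c) ∷ p) q α with ≡-dec ℕ._≟_ β α
... | yes _ = trans (cong (c ℚ.+_) (coeff-++ p q α)) (sym (ℚP.+-assoc c _ _))
... | no _ = coeff-++ p q α

coeff-scaleP : ∀ {n} c (p : Poly n) α → coeff (scaleP c p) α ≡ c ℚ.* coeff p α
coeff-scaleP c [] α = sym (ℚP.*-zeroʳ c)
coeff-scaleP c ((β , d) ∷ p) α with ≡-dec ℕ._≟_ β α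
... | yes _ = trans (cong (c ℚ.* d ℚ.+_) (coeff-scaleP c p α)) (sym (ℚP.*-distribˡ-+ c d _))
... | no _ = coeff-scaleP c p α

coeff-neg : ∀ {n} (p : Poly n) α → coeff (-P p) α ≡ ℚ.- coeff p α
coeff-neg [] α = refl
coeff-neg ((β , d) ∷ p) α with ≡-dec ℕ._≟_ β α
... | yes _ = trans (cong (ℚ.- d ℚ.+_) (coeff-neg p α)) (sym (ℚP.neg-distrib-+ d _))
... | no _ = coeff-neg p α

+-cong : ∀ {n} {p p' q q' : Poly n} → p ≋ p' → q ≋ q' → p ++ q ≋ p' ++ q'
+-cong {p = p} {p'} {q} {q'} (mk e) (mk f) = mk λ α → begin
  coeff (p ++ q) α          ≡⟨ coeff-++ p q α ⟩
  coeff p α ℚ.+ coeff q α   ≡⟨ cong₂ ℚ._+_ (e α) (f α) ⟩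
  coeff p' α ℚ.+ coeff q' α ≡⟨ coeff-++ p' q' α ⟨
  coeff (p' ++ q') α        ∎
  where open ≡-Reasoning

+-congˡ : ∀ {n} {p p' : Poly n} q → p ≋ p' → p ++ q ≋ p' ++ q
+-congˡ q e = +-cong {q = q} e ≋-refl

+-congʳ : ∀ {n} (p : Poly n) {q q'} → q ≋ q' → p ++ q ≋ p ++ q'
+-congʳ p e = +-cong {p = p} ≋-refl e

+-assoc : ∀ {n} (p q r : Poly n) → (p ++ q) ++ r ≋ p ++ (q ++ r)
+-assoc p q r = ≡⇒≋ (ListP.++-assoc p q r)

+-comm : ∀ {n} (p q : Poly n) → p ++ q ≋ q ++ p
+-comm p q = mk λ α → begin
  coeff (p ++ q) α        ≡⟨ coeff-++ p q α ⟩
  coeff p α ℚ.+ coeff q α ≡⟨ ℚP.+-comm (coeff p α) _ ⟩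
  coeff q α ℚ.+ coeff p α ≡⟨ coeff-++ q p α ⟨
  coeff (q ++ p) α        ∎
  where open ≡-Reasoning

+-identityʳ : ∀ {n} (p : Poly n) → p ++ [] ≋ p
+-identityʳ p = ≡⇒≋ (ListP.++-identityʳ p)

+-interchange : ∀ {n} (a b c d : Poly n) → (a ++ b) ++ (c ++ d) ≋ (a ++ c) ++ (b ++ d)
+-interchange a b c d = mk λ α → begin
  coeff ((a ++ b) ++ (c ++ d)) α
    ≡⟨ trans (coeff-++ (a ++ b) _ α) (cong₂ ℚ._+_ (coeff-++ a b α) (coeff-++ c d α)) ⟩
  (coeff a α ℚ.+ coeff b α) ℚ.+ (coeff c α ℚ.+ coeff d α)
    ≡⟨ CommSemigroupProperties.interchange ℚ-+-commutativeSemigroup (coeff a α) (coeff b α) (coeff c α) (coeff d α) ⟩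
  (coeff a α ℚ.+ coeff c α) ℚ.+ (coeff b α ℚ.+ coeff d α)
    ≡⟨ trans (coeff-++ (a ++ c) _ α) (cong₂ ℚ._+_ (coeff-++ a c α) (coeff-++ b d α)) ⟨
  coeff ((a ++ c) ++ (b ++ d)) α
    ∎
  where open ≡-Reasoning

neg-cong : ∀ {n} {p q : Poly n} → p ≋ q → -P p ≋ -P q
neg-cong {p = p} {q} (mk e) = mk λ α → trans (coeff-neg p α) (trans (cong ℚ.-_ (e α)) (sym (coeff-neg q α)))

neg-inverseˡ : ∀ {n} (p : Poly n) → (-P p) ++ p ≋ []
neg-inverseˡ p = mk λ α →
  trans (coeff-++ (-P p) p α) (trans (cong (ℚ._+ coeff p α) (coeff-neg p α)) (ℚP.+-inverseˡ (coeff p α)))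

scaleP-cong : ∀ {n} c {p q : Poly n} → p ≋ q → scaleP c p ≋ scaleP c q
scaleP-cong c {p} {q} (mk e) = mk λ α →
  trans (coeff-scaleP c p α) (trans (cong (c ℚ.*_) (e α)) (sym (coeff-scaleP c q α)))

scaleP-distribʳ : ∀ {n} a b (p : Poly n) → scaleP (a ℚ.+ b) p ≋ scaleP a p ++ scaleP b p
scaleP-distribʳ a b p = mk λ α → begin
  coeff (scaleP (a ℚ.+ b) p) α                     ≡⟨ coeff-scaleP (a ℚ.+ b) p α ⟩
  (a ℚ.+ b) ℚ.* coeff p α                          ≡⟨ ℚP.*-distribʳ-+ (coeff p α) a b ⟩
  a ℚ.* coeff p α ℚ.+ b ℚ.* coeff p α              ≡⟨ cong₂ ℚ._+_ (coeff-scaleP a p α) (coeff-scaleP b p α) ⟨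
  coeff (scaleP a p) α ℚ.+ coeff (scaleP b p) α    ≡⟨ coeff-++ (scaleP a p) _ α ⟨
  coeff (scaleP a p ++ scaleP b p) α               ∎
  where open ≡-Reasoning

scaleP-zero : ∀ {n} (p : Poly n) → scaleP 0ℚ p ≋ []
scaleP-zero p = mk λ α → trans (coeff-scaleP 0ℚ p α) (ℚP.*-zeroˡ (coeff p α))

dropMono : ∀ {n} → Mono n → Poly n → Poly n
dropMono β [] = []
dropMono β ((γ , c) ∷ p) with ≡-dec ℕ._≟_ γ β
... | yes _ = dropMono β p
... | no _ = (γ , c) ∷ dropMono β p

coeff-dropMono-same : ∀ {n} β (p : Poly n) → coeff (dropMono β p) β ≡ 0ℚ
coeff-dropMono-same β [] = refl
coeff-dropMono-same β ((γ , c) ∷ p) with ≡-dec ℕ._≟_ γ β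
... | yes _ = coeff-dropMono-same β p
... | no ne with ≡-dec ℕ._≟_ γ β
...   | yes e = ⊥-elim (ne e)
...   | no _ = coeff-dropMono-same β p

coeff-dropMono-other : ∀ {n} β α (p : Poly n) → β ≢ α → coeff (dropMono β p) α ≡ coeff p α
coeff-dropMono-other β α [] ne = refl
coeff-dropMono-other β α ((γ , c) ∷ p) ne with ≡-dec ℕ._≟_ γ β
coeff-dropMono-other β α ((γ , c) ∷ p) ne | yes refl with ≡-dec ℕ._≟_ γ α
... | yes e = ⊥-elim (ne e)
... | no _ = coeff-dropMono-other β α p ne
coeff-dropMono-other β α ((γ , c) ∷ p) ne | no _ with ≡-dec ℕ._≟_ γ α
... | yes _ = cong (c ℚ.+_) (coeff-dropMono-other β α p ne)
... | no _ = coeff-dropMono-other β α p ne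

dropMono-cong : ∀ {n} β {p q : Poly n} → p ≋ q → dropMono β p ≋ dropMono β q
dropMono-cong β {p} {q} (mk e) = mk coeffs-agree
  where
  coeffs-agree : ∀ α → coeff (dropMono β p) α ≡ coeff (dropMono β q) α
  coeffs-agree α with ≡-dec ℕ._≟_ β α
  ... | yes refl = trans (coeff-dropMono-same β p) (sym (coeff-dropMono-same β q))
  ... | no ne = trans (coeff-dropMono-other β α p ne) (trans (e α) (sym (coeff-dropMono-other β α q ne)))

length-dropMono : ∀ {n} β (p : Poly n) → length (dropMono β p) ≤ length p
length-dropMono β [] = z≤n
length-dropMono β ((γ , c) ∷ p) with ≡-dec ℕ._≟_ γ β
... | yes _ = ℕP.m≤n⇒m≤1+n (length-dropMono β p)
... | no _ = s≤s (length-dropMono β p)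

length-dropMono-head : ∀ {n} β c (p : Poly n) → length (dropMono β ((β , c) ∷ p)) ≤ length p
length-dropMono-head β c p with ≡-dec ℕ._≟_ β β
... | yes _ = length-dropMono β p
... | no ne = ⊥-elim (ne refl)

-- subst σ is definitionally Lin (evalMono σ).
Lin : ∀ {n m} → (Mono n → Poly m) → Poly n → Poly m
Lin F p = foldr (λ t acc → scaleP (proj₂ t) (F (proj₁ t)) +P acc) 0P p

Lin-split : ∀ {n m} (F : Mono n → Poly m) β p →
  Lin F p ≋ scaleP (coeff p β) (F β) ++ Lin F (dropMono β p)
Lin-split F β [] = ≋-sym (+-congˡ [] (scaleP-zero (F β)))
Lin-split F β ((γ , c) ∷ p) with ≡-dec ℕ._≟_ γ β
... | yes refl =
      ≋-trans (+-congʳ (scaleP c (F β)) (Lin-split F β p))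
      (≋-trans (≋-sym (+-assoc (scaleP c (F β)) _ _))
               (+-congˡ (Lin F (dropMono β p)) (≋-sym (scaleP-distribʳ c (coeff p β) (F β)))))
... | no ne =
      ≋-trans (+-congʳ (scaleP c (F γ)) (Lin-split F β p))
      (≋-trans (≋-sym (+-assoc (scaleP c (F γ)) (scaleP (coeff p β) (F β)) (Lin F (dropMono β p))))
      (≋-trans (+-congˡ (Lin F (dropMono β p)) (+-comm (scaleP c (F γ)) (scaleP (coeff p β) (F β))))
      (+-assoc (scaleP (coeff p β) (F β)) (scaleP c (F γ)) (Lin F (dropMono β p)))))

Lin-cong-step : ∀ {n m} (F : Mono n → Poly m) β {p q} → p ≋ q →
  Lin F (dropMono β p) ≋ Lin F (dropMono β q) → Lin F p ≋ Lin F q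
Lin-cong-step F β {p} {q} (mk e) ih = ≋-trans (Lin-split F β p)
  (≋-trans (+-cong (≡⇒≋ (cong (λ c → scaleP c (F β)) (e β))) ih) (≋-sym (Lin-split F β q)))

Lin-cong-bounded : ∀ {n m} (F : Mono n → Poly m) k p q →
  length p ℕ.+ length q ≤ k → p ≋ q → Lin F p ≋ Lin F q
Lin-cong-bounded F k [] [] _ e = ≋-refl
Lin-cong-bounded F (suc k) ((β , c) ∷ r) q (s≤s le) e =
  Lin-cong-step F β e (Lin-cong-bounded F k (dropMono β ((β , c) ∷ r)) (dropMono β q)
    (ℕP.≤-trans (ℕP.+-mono-≤ (length-dropMono-head β c r) (length-dropMono β q)) le) (dropMono-cong β e))
Lin-cong-bounded F (suc k) [] ((β , c) ∷ r) (s≤s le) e =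
  Lin-cong-step F β e (Lin-cong-bounded F k [] (dropMono β ((β , c) ∷ r))
    (ℕP.≤-trans (length-dropMono-head β c r) le) (dropMono-cong β e))

Lin-cong : ∀ {n m} (F : Mono n → Poly m) {p q} → p ≋ q → Lin F p ≋ Lin F q
Lin-cong F {p} {q} e = Lin-cong-bounded F _ p q ℕP.≤-refl e

Lin-++ : ∀ {n m} (F : Mono n → Poly m) p q → Lin F (p ++ q) ≋ Lin F p ++ Lin F q
Lin-++ F [] q = ≋-refl
Lin-++ F (t ∷ p) q = ≋-trans (+-congʳ _ (Lin-++ F p q)) (≋-sym (+-assoc (scaleP (proj₂ t) (F (proj₁ t))) _ _))

Lin-ext-All : ∀ {n m} {P : Mono n → Set} (F G : Mono n → Poly m) → (∀ β → P β → F β ≋ G β) →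
  ∀ p → All (λ t → P (proj₁ t)) p → Lin F p ≋ Lin G p
Lin-ext-All F G e [] [] = ≋-refl
Lin-ext-All F G e ((β , c) ∷ p) (pb ∷ ap) = +-cong (scaleP-cong c (e β pb)) (Lin-ext-All F G e p ap)

-- Multiplication and the ring of polynomials

infixl 6 _⊕_
_⊕_ : ∀ {n} → Mono n → Mono n → Mono n
_⊕_ = Vec.zipWith ℕ._+_

zeroMono : ∀ n → Mono n
zeroMono n = Vec.replicate n 0

⊕-assoc : ∀ {n} (a b c : Mono n) → (a ⊕ b) ⊕ c ≡ a ⊕ (b ⊕ c)
⊕-assoc = VecP.zipWith-assoc ℕP.+-assoc

⊕-comm : ∀ {n} (a b : Mono n) → a ⊕ b ≡ b ⊕ a
⊕-comm = VecP.zipWith-comm ℕP.+-comm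

⊕-identityˡ : ∀ {n} (a : Mono n) → zeroMono n ⊕ a ≡ a
⊕-identityˡ = VecP.zipWith-identityˡ ℕP.+-identityˡ

infixr 7 _⋆_
_⋆_ : ∀ {n} → Mono n × ℚ → Poly n → Poly n
s ⋆ q = map (λ t → proj₁ s ⊕ proj₁ t , proj₂ s ℚ.* proj₂ t) q

⋆-++ : ∀ {n} (s : Mono n × ℚ) q r → s ⋆ (q ++ r) ≡ s ⋆ q ++ s ⋆ r
⋆-++ s q r = ListP.map-++ _ q r

*-distribʳ-≡ : ∀ {n} (p p' q : Poly n) → (p ++ p') *P q ≡ p *P q ++ p' *P q
*-distribʳ-≡ [] p' q = refl
*-distribʳ-≡ (s ∷ p) p' q = trans (cong (s ⋆ q ++_) (*-distribʳ-≡ p p' q)) (sym (ListP.++-assoc (s ⋆ q) _ _))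

*-zeroʳ : ∀ {n} (p : Poly n) → p *P [] ≡ []
*-zeroʳ [] = refl
*-zeroʳ (s ∷ p) = *-zeroʳ p

∷-cong : ∀ {n} β {c c' : ℚ} {a b : Poly n} → c ≡ c' → a ≋ b → (β , c) ∷ a ≋ (β , c') ∷ b
∷-cong β {c} refl e = +-congʳ ((β , c) ∷ []) e

⋆-Lin : ∀ {n} (s : Mono n × ℚ) q → s ⋆ q ≋ Lin (λ γ → (proj₁ s ⊕ γ , proj₂ s) ∷ []) q
⋆-Lin s [] = ≋-refl
⋆-Lin s ((γ , c) ∷ q) = ∷-cong (proj₁ s ⊕ γ) (ℚP.*-comm (proj₂ s) c) (⋆-Lin s q)

⋆-cong : ∀ {n} (s : Mono n × ℚ) {q q'} → q ≋ q' → s ⋆ q ≋ s ⋆ q'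
⋆-cong s {q} {q'} e =
  ≋-trans (⋆-Lin s q) (≋-trans (Lin-cong (λ γ → (proj₁ s ⊕ γ , proj₂ s) ∷ []) e) (≋-sym (⋆-Lin s q')))

*-congʳ : ∀ {n} (p : Poly n) {q q'} → q ≋ q' → p *P q ≋ p *P q'
*-congʳ [] e = ≋-refl
*-congʳ (s ∷ p) e = +-cong (⋆-cong s e) (*-congʳ p e)

scaleP-⋆ : ∀ {n} c β (q : Poly n) → scaleP c ((β , 1ℚ) ⋆ q) ≡ (β , c) ⋆ q
scaleP-⋆ c β [] = refl
scaleP-⋆ c β ((γ , d) ∷ q) = cong₂ _∷_ (cong (β ⊕ γ ,_) (cong (c ℚ.*_) (ℚP.*-identityˡ d))) (scaleP-⋆ c β q)

*-Lin : ∀ {n} (p q : Poly n) → p *P q ≋ Lin (λ β → (β , 1ℚ) ⋆ q) p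
*-Lin [] q = ≋-refl
*-Lin ((β , c) ∷ p) q = +-cong (≡⇒≋ (sym (scaleP-⋆ c β q))) (*-Lin p q)

*-congˡ : ∀ {n} {p p' : Poly n} q → p ≋ p' → p *P q ≋ p' *P q
*-congˡ {p = p} {p'} q e =
  ≋-trans (*-Lin p q) (≋-trans (Lin-cong (λ β → (β , 1ℚ) ⋆ q) e) (≋-sym (*-Lin p' q)))

*-cong : ∀ {n} {p p' q q' : Poly n} → p ≋ p' → q ≋ q' → p *P q ≋ p' *P q'
*-cong {p' = p'} {q} e f = ≋-trans (*-congˡ q e) (*-congʳ p' f)

⋆-⋆ : ∀ {n} (s t : Mono n × ℚ) r → (proj₁ s ⊕ proj₁ t , proj₂ s ℚ.* proj₂ t) ⋆ r ≡ s ⋆ t ⋆ r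
⋆-⋆ s t [] = refl
⋆-⋆ s t ((γ , c) ∷ r) =
  cong₂ _∷_ (cong₂ _,_ (⊕-assoc (proj₁ s) (proj₁ t) γ) (ℚP.*-assoc (proj₂ s) (proj₂ t) c)) (⋆-⋆ s t r)

⋆-* : ∀ {n} (s : Mono n × ℚ) q r → (s ⋆ q) *P r ≡ s ⋆ (q *P r)
⋆-* s [] r = refl
⋆-* s (t ∷ q) r = trans (cong₂ _++_ (⋆-⋆ s t r) (⋆-* s q r)) (sym (⋆-++ s (t ⋆ r) (q *P r)))

*-assoc : ∀ {n} (p q r : Poly n) → (p *P q) *P r ≡ p *P (q *P r)
*-assoc [] q r = refl
*-assoc (s ∷ p) q r = trans (*-distribʳ-≡ (s ⋆ q) (p *P q) r) (cong₂ _++_ (⋆-* s q r) (*-assoc p q r))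

*-singleton : ∀ {n} (q : Poly n) s → q *P (s ∷ []) ≡ s ⋆ q
*-singleton [] s = refl
*-singleton ((γ , c) ∷ q) (β , d) = cong₂ _∷_ (cong₂ _,_ (⊕-comm γ β) (ℚP.*-comm c d)) (*-singleton q (β , d))

*-distribˡ : ∀ {n} (p q r : Poly n) → p *P (q ++ r) ≋ p *P q ++ p *P r
*-distribˡ [] q r = ≋-refl
*-distribˡ (s ∷ p) q r = ≋-trans (≡⇒≋ (cong (_++ p *P (q ++ r)) (⋆-++ s q r)))
  (≋-trans (+-congʳ (s ⋆ q ++ s ⋆ r) (*-distribˡ p q r)) (+-interchange (s ⋆ q) (s ⋆ r) (p *P q) (p *P r)))

*-comm : ∀ {n} (p q : Poly n) → p *P q ≋ q *P p
*-comm [] q = ≡⇒≋ (sym (*-zeroʳ q))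
*-comm (s ∷ p) q =
  ≋-trans (+-cong (≡⇒≋ (sym (*-singleton q s))) (*-comm p q)) (≋-sym (*-distribˡ q (s ∷ []) p))

⋆-identityˡ : ∀ {n} (p : Poly n) → (zeroMono n , 1ℚ) ⋆ p ≡ p
⋆-identityˡ [] = refl
⋆-identityˡ ((β , c) ∷ p) = cong₂ _∷_ (cong₂ _,_ (⊕-identityˡ β) (ℚP.*-identityˡ c)) (⋆-identityˡ p)

*-identityˡ : ∀ {n} (p : Poly n) → 1P *P p ≋ p
*-identityˡ p = ≋-trans (+-identityʳ _) (≡⇒≋ (⋆-identityˡ p))

*-identityʳ : ∀ {n} (p : Poly n) → p *P 1P ≋ p
*-identityʳ p = ≋-trans (*-comm p 1P) (*-identityˡ p)

Poly-commutativeRing : ℕ → CommutativeRing 0ℓ 0ℓ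
Poly-commutativeRing n = record
  { Carrier = Poly n ; _≈_ = _≋_ ; _+_ = _++_ ; _*_ = _*P_ ; -_ = -P_ ; 0# = [] ; 1# = 1P
  ; isCommutativeRing = record
    { isRing = record
      { +-isAbelianGroup = record
        { isGroup = record
          { isMonoid = record
            { isSemigroup = record
              { isMagma = record
                { isEquivalence = record { refl = ≋-refl ; sym = ≋-sym ; trans = ≋-trans }
                ; ∙-cong = +-cong }
              ; assoc = +-assoc }
            ; identity = (λ p → ≋-refl) , +-identityʳ }
          ; inverse = neg-inverseˡ , (λ p → ≋-trans (+-comm p (-P p)) (neg-inverseˡ p))
          ; ⁻¹-cong = neg-cong }
        ; comm = +-comm }
      ; *-cong = *-cong
      ; *-assoc = λ p q r → ≡⇒≋ (*-assoc p q r)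
      ; *-identity = *-identityˡ , *-identityʳ
      ; distrib = *-distribˡ , (λ p q r → ≡⇒≋ (*-distribʳ-≡ q r p)) }
    ; *-comm = *-comm } }

module PolyReasoning (n : ℕ) = SetoidReasoning (CommutativeRing.setoid (Poly-commutativeRing n))

const : ∀ {n} → ℚ → Poly n
const {n} c = (zeroMono n , c) ∷ []

const-* : ∀ {n} a b → const {n} (a ℚ.* b) ≋ const a *P const b
const-* {n} a b = ≡⇒≋ (cong (λ z → (z , a ℚ.* b) ∷ []) (sym (⊕-identityˡ (zeroMono n))))

scaleP-const : ∀ {n} c (p : Poly n) → scaleP c p ≋ const c *P p
scaleP-const {n} c p = ≋-trans (≡⇒≋ (as-⋆ p)) (≋-sym (+-identityʳ ((zeroMono n , c) ⋆ p)))
  where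
  as-⋆ : ∀ p → scaleP c p ≡ (zeroMono n , c) ⋆ p
  as-⋆ [] = refl
  as-⋆ ((β , d) ∷ p) = cong₂ _∷_ (cong (_, c ℚ.* d) (sym (⊕-identityˡ β))) (as-⋆ p)

const-+ : ∀ {n} a b → const {n} (a ℚ.+ b) ≋ const a ++ const b
const-+ {n} a b = mk λ α → trans (coeffs α) (sym (coeff-++ (const a) (const b) α))
  where
  coeffs : ∀ α → coeff (const {n} (a ℚ.+ b)) α ≡ coeff (const {n} a) α ℚ.+ coeff (const {n} b) α
  coeffs α with ≡-dec ℕ._≟_ (zeroMono n) α
  ... | yes _ = trans (ℚP.+-identityʳ (a ℚ.+ b)) (cong₂ ℚ._+_ (sym (ℚP.+-identityʳ a)) (sym (ℚP.+-identityʳ b)))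
  ... | no _ = refl

const-0 : ∀ {n} → const {n} 0ℚ ≋ []
const-0 {n} = mk coeffs
  where
  coeffs : ∀ α → coeff (const {n} 0ℚ) α ≡ 0ℚ
  coeffs α with ≡-dec ℕ._≟_ (zeroMono n) α
  ... | yes _ = refl
  ... | no _ = refl

-- The solver takes its constants from ℚ (via const) rather than from Poly n itself, so that
-- the constant arithmetic in its normal forms computes.
module PolySolver (n : ℕ) where
  private
    PolyACR : AlmostCommutativeRing 0ℓ 0ℓ
    PolyACR = fromCommutativeRing (Poly-commutativeRing n)
    ℚ-rawRing : RawRing 0ℓ 0ℓ
    ℚ-rawRing = CommutativeRing.rawRing ℚP.+-*-commutativeRing

    const-homomorphism : ℚ-rawRing -Raw-AlmostCommutative⟶ PolyACR
    const-homomorphism = record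
      { ⟦_⟧ = const ; +-homo = const-+ ; *-homo = const-* ; -‿homo = λ _ → ≋-refl
      ; 0-homo = const-0 ; 1-homo = ≋-refl }

    const-≟ : ∀ a b → Maybe (const {n} a ≋ const b)
    const-≟ a b with a ℚP.≟ b
    ... | yes refl = just ≋-refl
    ... | no _ = nothing

  open RingSolver ℚ-rawRing PolyACR const-homomorphism const-≟ public

^-cong : ∀ {n} {p q : Poly n} k → p ≋ q → p ^P k ≋ q ^P k
^-cong zero e = ≋-refl
^-cong (suc k) e = *-cong e (^-cong k e)

^-distribˡ-+-* : ∀ {n} (p : Poly n) a b → p ^P (a ℕ.+ b) ≋ p ^P a *P p ^P b
^-distribˡ-+-* p zero b = ≋-sym (*-identityˡ (p ^P b))
^-distribˡ-+-* p (suc a) b =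
  ≋-trans (*-congʳ p (^-distribˡ-+-* p a b)) (≋-sym (≡⇒≋ (*-assoc p (p ^P a) (p ^P b))))

prodPow : ∀ {m k} → Vec (Poly m) k → Vec ℕ k → Poly m
prodPow {m} xs β = Vec.foldr (λ _ → Poly m) _*P_ 1P (Vec.zipWith _^P_ xs β)

evalMono : ∀ {n m} → (Fin n → Poly m) → Mono n → Poly m
evalMono σ α = prodPow (Vec.tabulate σ) α

prodPow-⊕ : ∀ {m k} (xs : Vec (Poly m) k) β γ → prodPow xs (β ⊕ γ) ≋ prodPow xs β *P prodPow xs γ
prodPow-⊕ [] [] [] = ≋-sym (*-identityˡ 1P)
prodPow-⊕ {m} (x ∷ xs) (b ∷ β) (c ∷ γ) =
  ≋-trans (*-cong (^-distribˡ-+-* x b c) (prodPow-⊕ xs β γ))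
          (swap-middle (x ^P b) (x ^P c) (prodPow xs β) (prodPow xs γ))
  where
  open PolySolver m
  swap-middle : ∀ a b c d → (a *P b) *P (c *P d) ≋ (a *P c) *P (b *P d)
  swap-middle = solve 4 (λ a b c d → (a :* b) :* (c :* d) := (a :* c) :* (b :* d)) ≋-refl

subst-⋆ : ∀ {n m} (σ : Fin n → Poly m) (s : Mono n × ℚ) q →
  subst σ (s ⋆ q) ≋ scaleP (proj₂ s) (evalMono σ (proj₁ s)) *P subst σ q
subst-⋆ σ s [] = ≡⇒≋ (sym (*-zeroʳ (scaleP (proj₂ s) (evalMono σ (proj₁ s)))))
subst-⋆ {n} {m} σ (β , a) ((γ , c) ∷ q) = begin
    scaleP (a ℚ.* c) (evalMono σ (β ⊕ γ)) ++ subst σ ((β , a) ⋆ q)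
  ≈⟨ +-cong (≋-trans (scaleP-const (a ℚ.* c) _) (*-cong (const-* a c) (prodPow-⊕ (Vec.tabulate σ) β γ)))
            (≋-trans (subst-⋆ σ (β , a) q) (*-congˡ (subst σ q) (scaleP-const a (evalMono σ β)))) ⟩
    (const a *P const c) *P (evalMono σ β *P evalMono σ γ) ++ (const a *P evalMono σ β) *P subst σ q
  ≈⟨ factor (const a) (const c) (evalMono σ β) (evalMono σ γ) (subst σ q) ⟩
    (const a *P evalMono σ β) *P (const c *P evalMono σ γ ++ subst σ q)
  ≈⟨ *-cong (≋-sym (scaleP-const a (evalMono σ β))) (+-congˡ (subst σ q) (≋-sym (scaleP-const c (evalMono σ γ)))) ⟩
    scaleP a (evalMono σ β) *P subst σ ((γ , c) ∷ q) ∎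
  where
  open PolyReasoning m
  open PolySolver m
  factor : ∀ a c x y z →
    (a *P c) *P (x *P y) ++ (a *P x) *P z ≋ (a *P x) *P (c *P y ++ z)
  factor = solve 5 (λ a c x y z → ((a :* c) :* (x :* y)) :+ ((a :* x) :* z)
                               := (a :* x) :* ((c :* y) :+ z)) ≋-refl

subst-* : ∀ {n m} (σ : Fin n → Poly m) p q → subst σ (p *P q) ≋ subst σ p *P subst σ q
subst-* σ [] q = ≋-refl
subst-* σ (s ∷ p) q = ≋-trans (Lin-++ (evalMono σ) (s ⋆ q) (p *P q))
  (≋-trans (+-cong (subst-⋆ σ s q) (subst-* σ p q))
           (≡⇒≋ (sym (*-distribʳ-≡ (scaleP (proj₂ s) (evalMono σ (proj₁ s))) (subst σ p) (subst σ q)))))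

Supported : ∀ {n} → (Mono n → Set) → Poly n → Set
Supported P p = ∀ α → coeff p α ≢ 0ℚ → P α

module _ {n} (P : Mono n → Set) (P? : ∀ β → Dec (P β)) where

  filterMonos : Poly n → Poly n
  filterMonos [] = []
  filterMonos ((β , c) ∷ p) with P? β
  ... | yes _ = (β , c) ∷ filterMonos p
  ... | no _ = filterMonos p

  coeff-filterMonos-yes : ∀ p α → P α → coeff (filterMonos p) α ≡ coeff p α
  coeff-filterMonos-yes [] α pa = refl
  coeff-filterMonos-yes ((β , c) ∷ p) α pa with P? β
  ... | yes _ with ≡-dec ℕ._≟_ β α
  ...   | yes _ = cong (c ℚ.+_) (coeff-filterMonos-yes p α pa)
  ...   | no _ = coeff-filterMonos-yes p α pa
  coeff-filterMonos-yes ((β , c) ∷ p) α pa | no ¬pb with ≡-dec ℕ._≟_ β α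
  ...   | yes refl = ⊥-elim (¬pb pa)
  ...   | no _ = coeff-filterMonos-yes p α pa

  coeff-filterMonos-no : ∀ p α → ¬ P α → coeff (filterMonos p) α ≡ 0ℚ
  coeff-filterMonos-no [] α ¬pa = refl
  coeff-filterMonos-no ((β , c) ∷ p) α ¬pa with P? β
  ... | yes pb with ≡-dec ℕ._≟_ β α
  ...   | yes refl = ⊥-elim (¬pa pb)
  ...   | no _ = coeff-filterMonos-no p α ¬pa
  coeff-filterMonos-no ((β , c) ∷ p) α ¬pa | no _ = coeff-filterMonos-no p α ¬pa

  filterMonos-≋ : ∀ p → Supported P p → filterMonos p ≋ p
  filterMonos-≋ p sp = mk coeffs
    where
    coeffs : ∀ α → coeff (filterMonos p) α ≡ coeff p α
    coeffs α with P? α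
    ... | yes pa = coeff-filterMonos-yes p α pa
    ... | no ¬pa with coeff p α ℚP.≟ 0ℚ
    ...   | yes z = trans (coeff-filterMonos-no p α ¬pa) (sym z)
    ...   | no nz = ⊥-elim (¬pa (sp α nz))

  All-filterMonos : ∀ p → All (λ t → P (proj₁ t)) (filterMonos p)
  All-filterMonos [] = []
  All-filterMonos ((β , c) ∷ p) with P? β
  ... | yes pb = pb ∷ All-filterMonos p
  ... | no _ = All-filterMonos p

All⇒Supported : ∀ {n} {P : Mono n → Set} p → All (λ t → P (proj₁ t)) p → Supported P p
All⇒Supported [] [] α nz = ⊥-elim (nz refl)
All⇒Supported ((β , c) ∷ p) (pb ∷ ap) α nz with ≡-dec ℕ._≟_ β α
... | yes refl = pb
... | no _ = All⇒Supported p ap α nz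

Supported-cong : ∀ {n} {P : Mono n → Set} {p q} → p ≋ q → Supported P p → Supported P q
Supported-cong (mk e) sp α nz = sp α (λ z → nz (trans (sym (e α)) z))

Supported-++ : ∀ {n} {P : Mono n → Set} p q → Supported P p → Supported P q → Supported P (p ++ q)
Supported-++ p q sp sq α nz with coeff p α ℚP.≟ 0ℚ
... | no pz = sp α pz
... | yes pz = sq α (λ qz → nz (trans (coeff-++ p q α) (cong₂ ℚ._+_ pz qz)))

Supported-scaleP : ∀ {n} {P : Mono n → Set} c p → Supported P p → Supported P (scaleP c p)
Supported-scaleP c p sp α nz = sp α (λ z → nz (trans (coeff-scaleP c p α) (trans (cong (c ℚ.*_) z) (ℚP.*-zeroʳ c))))

Supported-neg : ∀ {n} {P : Mono n → Set} p → Supported P p → Supported P (-P p)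
Supported-neg p sp α nz = sp α (λ z → nz (trans (coeff-neg p α) (cong ℚ.-_ z)))

Supported-[] : ∀ {n} {P : Mono n → Set} → Supported P []
Supported-[] α nz = ⊥-elim (nz refl)

deg-⊕ : ∀ {n} (β γ : Mono n) → deg (β ⊕ γ) ≡ deg β ℕ.+ deg γ
deg-⊕ [] [] = refl
deg-⊕ (x ∷ β) (y ∷ γ) = trans (cong (x ℕ.+ y ℕ.+_) (deg-⊕ β γ))
  (CommSemigroupProperties.interchange ℕP.+-commutativeSemigroup x y (deg β) (deg γ))

deg-zeroMono : ∀ n → deg (zeroMono n) ≡ 0
deg-zeroMono zero = refl
deg-zeroMono (suc n) = deg-zeroMono n

HasDeg : ∀ {n} → ℕ → Mono n → Set
HasDeg e α = deg α ≡ e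

hasDeg? : ∀ {n} e (α : Mono n) → Dec (HasDeg e α)
hasDeg? e α = deg α ℕ.≟ e

homogPart : ∀ {n} → ℕ → Poly n → Poly n
homogPart e = filterMonos (HasDeg e) (hasDeg? e)

homogPart-≋ : ∀ {n} e (p : Poly n) → Homog e p → homogPart e p ≋ p
homogPart-≋ e = filterMonos-≋ (HasDeg e) (hasDeg? e)

All-homogPart : ∀ {n} e (p : Poly n) → All (λ t → HasDeg e (proj₁ t)) (homogPart e p)
All-homogPart e = All-filterMonos (HasDeg e) (hasDeg? e)

All-⋆ : ∀ {n} a b (s : Mono n × ℚ) q → HasDeg a (proj₁ s) →
  All (λ t → HasDeg b (proj₁ t)) q → All (λ t → HasDeg (a ℕ.+ b) (proj₁ t)) (s ⋆ q)
All-⋆ a b s [] ds [] = []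
All-⋆ a b s (t ∷ q) ds (dt ∷ aq) = trans (deg-⊕ (proj₁ s) (proj₁ t)) (cong₂ ℕ._+_ ds dt) ∷ All-⋆ a b s q ds aq

All-* : ∀ {n} a b (p q : Poly n) → All (λ t → HasDeg a (proj₁ t)) p →
  All (λ t → HasDeg b (proj₁ t)) q → All (λ t → HasDeg (a ℕ.+ b) (proj₁ t)) (p *P q)
All-* a b [] q [] aq = []
All-* a b (s ∷ p) q (ds ∷ ap) aq = AllP.++⁺ (All-⋆ a b s q ds aq) (All-* a b p q ap aq)

Homog-* : ∀ {n} a b (p q : Poly n) → Homog a p → Homog b q → Homog (a ℕ.+ b) (p *P q)
Homog-* a b p q hp hq = Supported-cong (*-cong (homogPart-≋ a p hp) (homogPart-≋ b q hq))
  (All⇒Supported (homogPart a p *P homogPart b q)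
    (All-* a b (homogPart a p) (homogPart b q) (All-homogPart a p) (All-homogPart b q)))

Homog-1P : ∀ {n} → Homog 0 (1P {n})
Homog-1P {n} = All⇒Supported (1P {n}) (deg-zeroMono n ∷ [])

Homog-^ : ∀ {n} (x : Poly n) k → Homog 1 x → Homog k (x ^P k)
Homog-^ x zero hx = Homog-1P
Homog-^ x (suc k) hx = Homog-* 1 k x (x ^P k) hx (Homog-^ x k hx)

Homog-prodPow : ∀ {m k} (σ : Fin k → Poly m) → (∀ j → Homog 1 (σ j)) →
  ∀ β → Homog (deg β) (prodPow (Vec.tabulate σ) β)
Homog-prodPow σ hσ [] = Homog-1P
Homog-prodPow σ hσ (b ∷ β) =
  Homog-* b (deg β) (head σ ^P b) (prodPow (Vec.tabulate (tail σ)) β) (Homog-^ (head σ) b (hσ zero))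
  (Homog-prodPow (tail σ) (λ j → hσ (suc j)) β)

Homog-Lin-All : ∀ {n m} e (F : Mono n → Poly m) → (∀ β → HasDeg e β → Homog e (F β)) →
  ∀ p → All (λ t → HasDeg e (proj₁ t)) p → Homog e (Lin F p)
Homog-Lin-All e F hF [] [] = Supported-[]
Homog-Lin-All e F hF ((β , c) ∷ p) (d ∷ ap) =
  Supported-++ (scaleP c (F β)) (Lin F p) (Supported-scaleP c (F β) (hF β d)) (Homog-Lin-All e F hF p ap)

Homog-subst : ∀ {n m} (σ : Fin n → Poly m) → (∀ j → Homog 1 (σ j)) → ∀ e p → Homog e p → Homog e (subst σ p)
Homog-subst σ hσ e p hp = Supported-cong (Lin-cong (evalMono σ) (homogPart-≋ e p hp))
  (Homog-Lin-All e (evalMono σ) (λ β d α nz → trans (Homog-prodPow σ hσ β α nz) d) (homogPart e p) (All-homogPart e p))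

support-Any : ∀ {n} (p : Poly n) α → coeff p α ≢ 0ℚ → Any (λ t → proj₁ t ≡ α) p
support-Any [] α nz = ⊥-elim (nz refl)
support-Any ((β , c) ∷ p) α nz with ≡-dec ℕ._≟_ β α
... | yes e = here e
... | no _ = there (support-Any p α nz)

-- Only the monomials occurring in the list need to be tested.
nonZero? : ∀ {n} (p : Poly n) → Dec (NonZeroP p)
nonZero? p with Any.any? (λ t → ¬? (coeff p (proj₁ t) ℚP.≟ 0ℚ)) p
... | yes a = let (t , ne) = Any.satisfied a in yes (proj₁ t , ne)
... | no na = no λ { (α , nz) →
        na (Any.map (λ {t} e z → nz (Eq.subst (λ β → coeff p β ≡ 0ℚ) e z)) (support-Any p α nz)) }

¬NonZero⇒≋[] : ∀ {n} (p : Poly n) → ¬ NonZeroP p → p ≋ []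
¬NonZero⇒≋[] p nn = mk coeffs
  where
  coeffs : ∀ α → coeff p α ≡ 0ℚ
  coeffs α with coeff p α ℚP.≟ 0ℚ
  ... | yes z = z
  ... | no z = ⊥-elim (nn (α , z))

sumP-cong : ∀ {n k} {F G : Fin k → Poly n} → (∀ i → F i ≋ G i) → sumP F ≋ sumP G
sumP-cong {k = zero} e = ≋-refl
sumP-cong {k = suc k} e = +-cong (e zero) (sumP-cong (λ i → e (suc i)))

sumP-zero : ∀ {n k} (F : Fin k → Poly n) → (∀ i → F i ≋ []) → sumP F ≋ []
sumP-zero {k = zero} F e = ≋-refl
sumP-zero {k = suc k} F e = +-cong (e zero) (sumP-zero (tail F) (λ i → e (suc i)))

sumP-++ : ∀ {n k} (F G : Fin k → Poly n) → sumP (λ i → F i ++ G i) ≋ sumP F ++ sumP G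
sumP-++ {k = zero} F G = ≋-refl
sumP-++ {k = suc k} F G = ≋-trans (+-congʳ (F zero ++ G zero) (sumP-++ (tail F) (tail G)))
  (+-interchange (F zero) (G zero) (sumP (tail F)) (sumP (tail G)))

sumP-*ʳ : ∀ {n k} (F : Fin k → Poly n) r → sumP F *P r ≋ sumP (λ i → F i *P r)
sumP-*ʳ {k = zero} F r = ≋-refl
sumP-*ʳ {k = suc k} F r =
  ≋-trans (≡⇒≋ (*-distribʳ-≡ (F zero) (sumP (tail F)) r)) (+-congʳ (F zero *P r) (sumP-*ʳ (tail F) r))

neg-sumP : ∀ {n k} (F : Fin k → Poly n) → -P sumP F ≋ sumP (λ i → -P F i)
neg-sumP {k = zero} F = ≋-refl
neg-sumP {k = suc k} F =
  ≋-trans (≡⇒≋ (ListP.map-++ _ (F zero) (sumP (tail F)))) (+-congʳ (-P F zero) (neg-sumP (tail F)))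

subst-sumP : ∀ {n m k} (σ : Fin n → Poly m) (F : Fin k → Poly n) → subst σ (sumP F) ≋ sumP (λ i → subst σ (F i))
subst-sumP {k = zero} σ F = ≋-refl
subst-sumP {k = suc k} σ F =
  ≋-trans (Lin-++ (evalMono σ) (F zero) (sumP (tail F))) (+-congʳ (subst σ (F zero)) (subst-sumP σ (tail F)))

sumP-δ : ∀ {n k} (F : Fin k → Poly n) i → (∀ j → j ≢ i → F j ≋ []) → sumP F ≋ F i
sumP-δ {k = suc k} F zero e =
  ≋-trans (+-congʳ (F zero) (sumP-zero (tail F) (λ j → e (suc j) (λ ())))) (+-identityʳ (F zero))
sumP-δ {k = suc k} F (suc i) e = ≋-trans (+-congˡ (sumP (tail F)) (e zero (λ ())))
  (sumP-δ (tail F) i (λ j j≢i → e (suc j) (j≢i ∘ FinP.suc-injective)))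

tail-⧺ : ∀ {A : Set} {a b} (xs : Vector A (suc a)) (ys : Vector A b) i → (xs ⧺ ys) (suc i) ≡ (tail xs ⧺ ys) i
tail-⧺ {a = a} xs ys i with splitAt a i
... | inj₁ _ = refl
... | inj₂ _ = refl

All-⧺ : ∀ {A : Set} {a b} (P : A → Set) (xs : Vector A a) (ys : Vector A b) →
  (∀ i → P (xs i)) → (∀ i → P (ys i)) → ∀ i → P ((xs ⧺ ys) i)
All-⧺ {a = a} P xs ys pxs pys i with splitAt a i
... | inj₁ j = pxs j
... | inj₂ j = pys j

sumP-⧺ : ∀ {n a b} (F : Vector (Poly n) a) (G : Vector (Poly n) b) → sumP (F ⧺ G) ≋ sumP F ++ sumP G
sumP-⧺ {a = zero} F G = ≋-refl
sumP-⧺ {a = suc a} F G =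
  ≋-trans (+-congʳ (F zero) (≋-trans (sumP-cong (λ i → ≡⇒≋ (tail-⧺ F G i))) (sumP-⧺ (tail F) G)))
  (≋-sym (+-assoc (F zero) _ _))

HasDecomp-cong : ∀ {n} {f g : Poly n} k → f ≋ g → HasDecomp f k → HasDecomp g k
HasDecomp-cong {f = f} k e (U , W , pu , pw , eq) =
  U , W , pu , pw , get (≋-trans (≋-sym e) (≈⇒≋ f (sumP (λ i → U i *P W i)) eq))

HasDecomp-+ : ∀ {n} {f g₁ g₂ : Poly n} a b → HasDecomp g₁ a → HasDecomp g₂ b → f ≋ g₁ ++ g₂ →
  HasDecomp f (a ℕ.+ b)
HasDecomp-+ {g₁ = g₁} {g₂} a b (U₁ , W₁ , pu₁ , pw₁ , e₁) (U₂ , W₂ , pu₂ , pw₂ , e₂) e =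
  U₁ ⧺ U₂ , W₁ ⧺ W₂ , All-⧺ PosForm U₁ U₂ pu₁ pu₂ , All-⧺ PosForm W₁ W₂ pw₁ pw₂ ,
  get (≋-trans e (≋-trans (+-cong (≈⇒≋ g₁ (sumP P₁) e₁) (≈⇒≋ g₂ (sumP P₂) e₂))
       (≋-sym (≋-trans (sumP-cong (λ i → ≡⇒≋ (products-⧺ i))) (sumP-⧺ P₁ P₂)))))
  where
  P₁ P₂ : Fin _ → Poly _
  P₁ i = U₁ i *P W₁ i
  P₂ i = U₂ i *P W₂ i
  products-⧺ : ∀ i → (U₁ ⧺ U₂) i *P (W₁ ⧺ W₂) i ≡ (P₁ ⧺ P₂) i
  products-⧺ i with splitAt a i
  ... | inj₁ _ = refl
  ... | inj₂ _ = refl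

PosHomog : ∀ {n} → Poly n → Set
PosHomog p = Σ ℕ λ e → 1 ≤ e × Homog e p

PosHomog⇒PosForm : ∀ {n} (p : Poly n) → PosHomog p → NonZeroP p → PosForm p
PosHomog⇒PosForm p (e , 1≤e , hp) nz = e , 1≤e , hp , nz

HasDecomp-∷ : ∀ {n k} (u w p : Poly n) → PosForm u → PosForm w → HasDecomp p k → HasDecomp (u *P w ++ p) (suc k)
HasDecomp-∷ u w p pu pw (U , W , pU , pW , eq) =
  u ◂ U , w ◂ W , (λ { zero → pu ; (suc i) → pU i }) , (λ { zero → pw ; (suc i) → pW i }) ,
  get (+-congʳ (u *P w) (≈⇒≋ p (sumP (λ i → U i *P W i)) eq))

-- Discard the products with a zero factor.
sumProducts-HasDecomp : ∀ {n} k (U W : Fin k → Poly n) → (∀ i → PosHomog (U i)) → (∀ i → PosHomog (W i)) →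
  Σ ℕ λ k' → k' ≤ k × HasDecomp (sumP (λ i → U i *P W i)) k'
sumProducts-HasDecomp zero U W hu hw = 0 , z≤n , (λ ()) , (λ ()) , (λ ()) , (λ ()) , (λ α → refl)
sumProducts-HasDecomp (suc k) U W hu hw
  with sumProducts-HasDecomp k (tail U) (tail W) (hu ∘ suc) (hw ∘ suc)
... | k' , k'≤k , dec with nonZero? (U zero) | nonZero? (W zero)
...   | yes nu | yes nw = suc k' , s≤s k'≤k , HasDecomp-∷ (U zero) (W zero) _
          (PosHomog⇒PosForm (U zero) (hu zero) nu) (PosHomog⇒PosForm (W zero) (hw zero) nw) dec
...   | no nu | _ = k' , ℕP.m≤n⇒m≤1+n k'≤k ,
          HasDecomp-cong k' (≋-sym (+-congˡ (sumP (λ i → U (suc i) *P W (suc i)))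
            (*-congˡ (W zero) (¬NonZero⇒≋[] (U zero) nu)))) dec
...   | yes _ | no nw = k' , ℕP.m≤n⇒m≤1+n k'≤k ,
          HasDecomp-cong k' (≋-sym (+-congˡ (sumP (λ i → U (suc i) *P W (suc i)))
            (≋-trans (*-congʳ (U zero) (¬NonZero⇒≋[] (W zero) nw)) (≡⇒≋ (*-zeroʳ (U zero)))))) dec

unitMono : ∀ n → Fin n → Mono n
unitMono n j = Vec.updateAt (zeroMono n) j (λ _ → 1)

deg-unitMono : ∀ {n} (j : Fin n) → deg (unitMono n j) ≡ 1
deg-unitMono {suc n} zero = cong suc (deg-zeroMono n)
deg-unitMono {suc n} (suc j) = deg-unitMono j

Homog-X : ∀ {n} (j : Fin n) → Homog 1 (X j)
Homog-X j = All⇒Supported (X j) (deg-unitMono j ∷ [])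

monomial : ∀ {n} → Mono n → Poly n
monomial β = (β , 1ℚ) ∷ []

monomial-* : ∀ {n} (a b : Mono n) → monomial a *P monomial b ≋ monomial (a ⊕ b)
monomial-* a b = ≡⇒≋ (cong (λ c → (a ⊕ b , c) ∷ []) (ℚP.*-identityˡ 1ℚ))

scaleMono : ∀ {n} → ℕ → Mono n → Mono n
scaleMono {n} zero v = zeroMono n
scaleMono (suc b) v = v ⊕ scaleMono b v

monomial-^ : ∀ {n} (v : Mono n) b → monomial v ^P b ≋ monomial (scaleMono b v)
monomial-^ v zero = ≋-refl
monomial-^ v (suc b) = ≋-trans (*-congʳ (monomial v) (monomial-^ v b)) (monomial-* v (scaleMono b v))

monoComb : ∀ {n k} → (Fin k → Mono n) → Vec ℕ k → Mono n
monoComb {n} γ [] = zeroMono n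
monoComb γ (b ∷ bs) = scaleMono b (head γ) ⊕ monoComb (tail γ) bs

prodPow-monomial : ∀ {n k} (γ : Fin k → Mono n) bs →
  prodPow (Vec.tabulate (monomial ∘ γ)) bs ≋ monomial (monoComb γ bs)
prodPow-monomial γ [] = ≋-refl
prodPow-monomial γ (b ∷ bs) = ≋-trans (*-cong (monomial-^ (head γ) b) (prodPow-monomial (tail γ) bs))
  (monomial-* (scaleMono b (head γ)) (monoComb (tail γ) bs))

scaleMono-0∷ : ∀ {n} b (v : Mono n) → scaleMono b (0 ∷ v) ≡ 0 ∷ scaleMono b v
scaleMono-0∷ zero v = refl
scaleMono-0∷ (suc b) v = cong (Vec.zipWith ℕ._+_ (0 ∷ v)) (scaleMono-0∷ b v)

monoComb-0∷ : ∀ {n k} (γ : Fin k → Mono n) bs → monoComb ((0 ∷_) ∘ γ) bs ≡ 0 ∷ monoComb γ bs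
monoComb-0∷ γ [] = refl
monoComb-0∷ γ (b ∷ bs) = cong₂ _⊕_ (scaleMono-0∷ b (head γ)) (monoComb-0∷ (tail γ) bs)

scaleMono-unitMono-zero : ∀ n b → scaleMono b (unitMono (suc n) zero) ≡ b ∷ zeroMono n
scaleMono-unitMono-zero n zero = refl
scaleMono-unitMono-zero n (suc b) = trans (cong (unitMono (suc n) zero ⊕_) (scaleMono-unitMono-zero n b))
  (cong (suc b ∷_) (⊕-identityˡ (zeroMono n)))

monoComb-unitMono : ∀ n (β : Mono n) → monoComb (unitMono n) β ≡ β
monoComb-unitMono zero [] = refl
monoComb-unitMono (suc n) (b ∷ β) = begin
  scaleMono b (unitMono (suc n) zero) ⊕ monoComb ((0 ∷_) ∘ unitMono n) β
    ≡⟨ cong₂ _⊕_ (scaleMono-unitMono-zero n b) (monoComb-0∷ (unitMono n) β) ⟩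
  (b ∷ zeroMono n) ⊕ (0 ∷ monoComb (unitMono n) β)
    ≡⟨ cong₂ _∷_ (ℕP.+-identityʳ b) (trans (⊕-identityˡ _) (monoComb-unitMono n β)) ⟩
  b ∷ β
    ∎
  where open ≡-Reasoning

evalMono-X : ∀ {n} (β : Mono n) → evalMono X β ≋ monomial β
evalMono-X {n} β = ≋-trans (prodPow-monomial (unitMono n) β) (≡⇒≋ (cong monomial (monoComb-unitMono n β)))

prodPow-zeroMono : ∀ {m k} (a : Fin k → Poly m) → prodPow (Vec.tabulate a) (zeroMono k) ≋ 1P
prodPow-zeroMono {k = zero} a = ≋-refl
prodPow-zeroMono {k = suc k} a = ≋-trans (*-identityˡ _) (prodPow-zeroMono (tail a))

prodPow-unitMono : ∀ {m k} (a : Fin k → Poly m) j → prodPow (Vec.tabulate a) (unitMono k j) ≋ a j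
prodPow-unitMono {k = suc k} a zero =
  ≋-trans (*-cong (*-identityʳ (a zero)) (prodPow-zeroMono (tail a))) (*-identityʳ (a zero))
prodPow-unitMono {k = suc k} a (suc j) = ≋-trans (*-identityˡ _) (prodPow-unitMono (tail a) j)

prodPow-agree : ∀ {m k} (a c : Fin k → Poly m) β → (∀ j → lookup β j ≡ 0 ⊎ a j ≋ c j) →
  prodPow (Vec.tabulate a) β ≋ prodPow (Vec.tabulate c) β
prodPow-agree a c [] h = ≋-refl
prodPow-agree a c (b ∷ β) h = *-cong head-agrees (prodPow-agree (tail a) (tail c) β (h ∘ suc))
  where
  head-agrees : a zero ^P b ≋ c zero ^P b
  head-agrees with h zero
  ... | inj₁ refl = ≋-refl
  ... | inj₂ e = ^-cong b e

Lin-monomial : ∀ {n} (p : Poly n) → Lin monomial p ≋ p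
Lin-monomial [] = ≋-refl
Lin-monomial ((β , c) ∷ p) = ∷-cong β (ℚP.*-identityʳ c) (Lin-monomial p)

-- Ideal membership with homogeneous cofactors

Homog-const : ∀ {n} c → Homog 0 (const {n} c)
Homog-const {n} c = All⇒Supported (const {n} c) (deg-zeroMono n ∷ [])

deg≡0⇒zeroMono : ∀ {n} (β : Mono n) → deg β ≡ 0 → β ≡ zeroMono n
deg≡0⇒zeroMono [] _ = refl
deg≡0⇒zeroMono (zero ∷ β) d = cong (0 ∷_) (deg≡0⇒zeroMono β d)

prodPow-deg≡0 : ∀ {m k} (a : Fin k → Poly m) β → deg β ≡ 0 → prodPow (Vec.tabulate a) β ≋ 1P
prodPow-deg≡0 a β d rewrite deg≡0⇒zeroMono β d = prodPow-zeroMono a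

Lin-sub : ∀ {n m} (F G : Mono n → Poly m) p → Lin F p ++ -P Lin G p ≋ Lin (λ β → F β ++ -P G β) p
Lin-sub F G [] = ≋-refl
Lin-sub {m = m} F G ((β , c) ∷ p) =
  ≋-trans (+-cong (+-congˡ (Lin F p) (scaleP-const c (F β))) (neg-cong (+-congˡ (Lin G p) (scaleP-const c (G β)))))
  (≋-trans (factor (const c) (F β) (G β) (Lin F p) (Lin G p))
  (+-cong (≋-sym (scaleP-const c (F β ++ -P G β))) (Lin-sub F G p)))
  where
  open PolySolver m
  factor : ∀ a x y u v → (a *P x ++ u) ++ -P (a *P y ++ v) ≋ a *P (x ++ -P y) ++ (u ++ -P v)
  factor = solve 5 (λ a x y u v → ((a :* x) :+ u) :- ((a :* y) :+ v) := (a :* (x :- y)) :+ (u :- v)) ≋-refl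

module Ideal {n k} (G : Fin k → Poly n) where

  InIdeal : ℕ → Poly n → Set
  InIdeal e p = Σ (Fin k → Poly n) λ Q → (∀ i → Homog e (Q i)) × p ≋ sumP (λ i → G i *P Q i)

  InIdeal-cong : ∀ {e p q} → p ≋ q → InIdeal e p → InIdeal e q
  InIdeal-cong p≋q (Q , hQ , eq) = Q , hQ , ≋-trans (≋-sym p≋q) eq

  InIdeal-0 : ∀ e → InIdeal e []
  InIdeal-0 e =
    (λ _ → []) , (λ _ → Supported-[]) , ≋-sym (sumP-zero (λ i → G i *P []) (λ i → ≡⇒≋ (*-zeroʳ (G i))))

  InIdeal-≋[] : ∀ e {p} → p ≋ [] → InIdeal e p
  InIdeal-≋[] e p≋[] = InIdeal-cong (≋-sym p≋[]) (InIdeal-0 e)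

  InIdeal-+ : ∀ {e} p q → InIdeal e p → InIdeal e q → InIdeal e (p ++ q)
  InIdeal-+ p q (Q , hQ , eq) (Q' , hQ' , eq') =
    (λ i → Q i ++ Q' i) , (λ i → Supported-++ (Q i) (Q' i) (hQ i) (hQ' i)) ,
    ≋-trans (+-cong eq eq') (≋-trans (≋-sym (sumP-++ (λ i → G i *P Q i) (λ i → G i *P Q' i)))
      (sumP-cong (λ i → ≋-sym (*-distribˡ (G i) (Q i) (Q' i)))))

  InIdeal-* : ∀ {e} b p r → InIdeal e p → Homog b r → InIdeal (e ℕ.+ b) (p *P r)
  InIdeal-* {e} b p r (Q , hQ , eq) hr = (λ i → Q i *P r) , (λ i → Homog-* e b (Q i) r (hQ i) hr) ,
    ≋-trans (*-congˡ r eq) (≋-trans (sumP-*ʳ (λ i → G i *P Q i) r) (sumP-cong (λ i → ≡⇒≋ (*-assoc (G i) (Q i) r))))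

  InIdeal-*ˡ : ∀ {e} b r p → Homog b r → InIdeal e p → InIdeal (b ℕ.+ e) (r *P p)
  InIdeal-*ˡ {e} b r p hr p∈I =
    InIdeal-cong (*-comm p r) (Eq.subst (λ e' → InIdeal e' (p *P r)) (ℕP.+-comm e b) (InIdeal-* b p r p∈I hr))

  InIdeal-scaleP : ∀ {e} c p → InIdeal e p → InIdeal e (scaleP c p)
  InIdeal-scaleP c p p∈I = InIdeal-cong (≋-sym (scaleP-const c p)) (InIdeal-*ˡ 0 (const c) p (Homog-const c) p∈I)

  InIdeal-generator : ∀ i → InIdeal 0 (G i)
  InIdeal-generator i = δ , Homog-δ , ≋-sym (≋-trans (sumP-δ (λ j → G j *P δ j) i off-diagonal) on-diagonal)
    where
    δ : Fin k → Poly n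
    δ j with j FinP.≟ i
    ... | yes _ = 1P
    ... | no _ = []
    Homog-δ : ∀ j → Homog 0 (δ j)
    Homog-δ j with j FinP.≟ i
    ... | yes _ = Homog-1P
    ... | no _ = Supported-[]
    off-diagonal : ∀ j → j ≢ i → G j *P δ j ≋ []
    off-diagonal j j≢i with j FinP.≟ i
    ... | yes j≡i = ⊥-elim (j≢i j≡i)
    ... | no _ = ≡⇒≋ (*-zeroʳ (G j))
    on-diagonal : G i *P δ i ≋ G i
    on-diagonal with i FinP.≟ i
    ... | yes _ = *-identityʳ (G i)
    ... | no i≢i = ⊥-elim (i≢i refl)

  InIdeal-Lin-All : ∀ e (F : Mono n → Poly n) → (∀ β → HasDeg (suc e) β → InIdeal e (F β)) →
    ∀ p → All (λ t → HasDeg (suc e) (proj₁ t)) p → InIdeal e (Lin F p)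
  InIdeal-Lin-All e F h [] [] = InIdeal-0 e
  InIdeal-Lin-All e F h ((β , c) ∷ p) (dβ ∷ ap) =
    InIdeal-+ (scaleP c (F β)) (Lin F p) (InIdeal-scaleP c (F β) (h β dβ)) (InIdeal-Lin-All e F h p ap)

  -- Peel one factor off the monomial: x^(b+1) U - z^(b+1) V = (x - z) x^b U + z (x^b U - z^b V).
  prodPow-diff-∷ : ∀ {m} (a c : Fin (suc m) → Poly n) → (∀ j → Homog 1 (a j)) → (∀ j → Homog 1 (c j)) →
    (∀ j → InIdeal 0 (a j ++ -P c j)) → ∀ b β e → b ℕ.+ deg β ≡ suc e →
    InIdeal e (prodPow (Vec.tabulate a) (b ∷ β) ++ -P prodPow (Vec.tabulate c) (b ∷ β))
  prodPow-diff-∷ a c ha hc a-c zero (b ∷ β) e d =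
    InIdeal-cong (+-cong (≋-sym (*-identityˡ (prodPow (Vec.tabulate (tail a)) (b ∷ β))))
                         (neg-cong (≋-sym (*-identityˡ (prodPow (Vec.tabulate (tail c)) (b ∷ β))))))
      (prodPow-diff-∷ (tail a) (tail c) (ha ∘ suc) (hc ∘ suc) (a-c ∘ suc) b β e d)
  prodPow-diff-∷ {m} a c ha hc a-c (suc b) β e d =
    InIdeal-cong (≋-sym (peel (a zero) (a zero ^P b) (prodPow A β) (c zero) (c zero ^P b) (prodPow C β)))
      (InIdeal-+ _ _ (InIdeal-* e (a zero ++ -P c zero) P (a-c zero) Homog-P) (rest _ refl))
    where
    A C : Vec (Poly n) m
    A = Vec.tabulate (tail a)
    C = Vec.tabulate (tail c)
    P Q : Poly n
    P = prodPow (Vec.tabulate a) (b ∷ β)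
    Q = prodPow (Vec.tabulate c) (b ∷ β)
    Homog-P : Homog e P
    Homog-P α nz = trans (Homog-prodPow a ha (b ∷ β) α nz) (ℕP.suc-injective d)
    rest : ∀ e' → b ℕ.+ deg β ≡ e' → InIdeal e (c zero *P (P ++ -P Q))
    rest zero d' = InIdeal-≋[] e (≋-trans (*-congʳ (c zero)
      (≋-trans (+-cong (prodPow-deg≡0 a (b ∷ β) d') (neg-cong (prodPow-deg≡0 c (b ∷ β) d'))) (+-comm 1P (-P 1P))))
      (≋-trans (*-congʳ (c zero) (neg-inverseˡ 1P)) (≡⇒≋ (*-zeroʳ (c zero)))))
    rest (suc e') d' = Eq.subst (λ e'' → InIdeal e'' (c zero *P (P ++ -P Q))) (trans (sym d') (ℕP.suc-injective d))
      (InIdeal-*ˡ 1 (c zero) (P ++ -P Q) (hc zero) (prodPow-diff-∷ a c ha hc a-c b β e' d'))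
    open PolySolver n
    peel : ∀ x y u z w v → (x *P y) *P u ++ -P ((z *P w) *P v) ≋ (x ++ -P z) *P (y *P u) ++ z *P (y *P u ++ -P (w *P v))
    peel = solve 6 (λ x y u z w v → ((x :* y) :* u) :- ((z :* w) :* v)
                                 := ((x :- z) :* (y :* u)) :+ (z :* ((y :* u) :- (w :* v)))) ≋-refl

  prodPow-diff : ∀ {m} (a c : Fin m → Poly n) → (∀ j → Homog 1 (a j)) → (∀ j → Homog 1 (c j)) →
    (∀ j → InIdeal 0 (a j ++ -P c j)) → ∀ β e → deg β ≡ suc e →
    InIdeal e (prodPow (Vec.tabulate a) β ++ -P prodPow (Vec.tabulate c) β)
  prodPow-diff a c ha hc a-c (b ∷ β) e d = prodPow-diff-∷ a c ha hc a-c b β e d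

  sub-subst-InIdeal : (σ : Fin n → Poly n) → (∀ j → Homog 1 (σ j)) → (∀ j → InIdeal 0 (X j ++ -P σ j)) →
    ∀ e f → Homog (suc e) f → InIdeal e (f ++ -P subst σ f)
  sub-subst-InIdeal σ hσ X-σ e f hf =
    InIdeal-cong f-σf (InIdeal-Lin-All e (λ β → monomial β ++ -P evalMono σ β) monomial-diff F (All-homogPart (suc e) f))
    where
    F : Poly n
    F = homogPart (suc e) f
    F≋f : F ≋ f
    F≋f = homogPart-≋ (suc e) f hf
    monomial-diff : ∀ β → HasDeg (suc e) β → InIdeal e (monomial β ++ -P evalMono σ β)
    monomial-diff β dβ = InIdeal-cong (+-congˡ (-P evalMono σ β) (evalMono-X β))
      (prodPow-diff X σ Homog-X hσ X-σ β e dβ)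
    f-σf : Lin (λ β → monomial β ++ -P evalMono σ β) F ≋ f ++ -P subst σ f
    f-σf = ≋-trans (≋-sym (Lin-sub monomial (evalMono σ) F))
           (+-cong (≋-trans (Lin-monomial F) F≋f) (neg-cong (Lin-cong (evalMono σ) F≋f)))

-- The elimination of x_1, …, x_M

subst-X : ∀ {n m} (σ : Fin n → Poly m) j → subst σ (X j) ≋ σ j
subst-X {n} σ j = begin
  scaleP 1ℚ (evalMono σ (unitMono n j)) ++ [] ≈⟨ +-identityʳ _ ⟩
  scaleP 1ℚ (evalMono σ (unitMono n j))       ≈⟨ scaleP-const 1ℚ _ ⟩
  1P *P evalMono σ (unitMono n j)             ≈⟨ *-identityˡ _ ⟩
  evalMono σ (unitMono n j)                   ≈⟨ prodPow-unitMono σ j ⟩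
  σ j                                         ∎
  where open PolyReasoning _

h-subadditive : ∀ {n} {f g₁ g₂ : Poly n} {h a b} → (∀ k → k < h → ¬ HasDecomp f k) → f ≋ g₁ ++ g₂ →
  HasDecomp g₁ a → HasDecomp g₂ b → h ≤ a ℕ.+ b
h-subadditive {f = f} {g₁} {g₂} {a = a} {b} h-minimal f≋ g₁-dec g₂-dec =
  ℕP.≮⇒≥ (λ a+b<h → h-minimal (a ℕ.+ b) a+b<h (HasDecomp-+ {f = f} {g₁} {g₂} a b g₁-dec g₂-dec f≋))

module Ideal-HasDecomp {n k} (G : Fin k → Poly n) where
  open Ideal G

  InIdeal⇒HasDecomp : (∀ i → PosHomog (G i)) → ∀ e p → InIdeal (suc e) p → Σ ℕ λ a → a ≤ k × HasDecomp p a
  InIdeal⇒HasDecomp hG e p (Q , hQ , eq) =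
    let (a , a≤k , dec) = sumProducts-HasDecomp k G Q hG (λ i → suc e , s≤s z≤n , hQ i)
    in a , a≤k , HasDecomp-cong a (≋-sym eq) dec

module Elimination {n M : ℕ} (M≤n : M ≤ n) (ℓ : Fin M → Poly n)
  (hℓ : ∀ i → Homog 1 (ℓ i)) (oℓ : ∀ i → OnlyVarsFrom M (ℓ i)) where

  σ : Fin n → Poly n
  σ = σℓ M≤n ℓ

  generator : Fin M → Poly n
  generator i = X (inject≤ i M≤n) +P ℓ i

  open Ideal generator
  open Ideal-HasDecomp generator

  σ-cases : ∀ j → (Σ (toℕ j < M) λ j<M → σ j ≡ -P ℓ (fromℕ< j<M)) ⊎ (¬ toℕ j < M × σ j ≡ X j)
  σ-cases j with toℕ j <? M
  ... | yes j<M = inj₁ (j<M , refl)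
  ... | no j≮M = inj₂ (j≮M , refl)

  Homog-σ : ∀ j → Homog 1 (σ j)
  Homog-σ j with σ-cases j
  ... | inj₁ (j<M , e) rewrite e = Supported-neg (ℓ (fromℕ< j<M)) (hℓ (fromℕ< j<M))
  ... | inj₂ (_ , e) rewrite e = Homog-X j

  VarsFrom : Mono n → Set
  VarsFrom α = ∀ j → toℕ j < M → lookup α j ≡ 0

  varsFrom? : ∀ α → Dec (VarsFrom α)
  varsFrom? α = FinP.all? (λ j → (toℕ j <? M) →-dec (lookup α j ℕ.≟ 0))

  evalMono-σ : ∀ β → VarsFrom β → evalMono σ β ≋ monomial β
  evalMono-σ β β-vars = ≋-trans (prodPow-agree σ X β σ-agrees) (evalMono-X β)
    where
    σ-agrees : ∀ j → lookup β j ≡ 0 ⊎ σ j ≋ X j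
    σ-agrees j with σ-cases j
    ... | inj₁ (j<M , _) = inj₁ (β-vars j j<M)
    ... | inj₂ (_ , e) = inj₂ (≡⇒≋ e)

  -- OnlyVarsFrom M p unfolds to Supported VarsFrom p.
  subst-σ-fixes : ∀ p → OnlyVarsFrom M p → subst σ p ≋ p
  subst-σ-fixes p p-vars = begin
    subst σ p                          ≈⟨ Lin-cong (evalMono σ) (≋-sym p′≋p) ⟩
    Lin (evalMono σ) p′                ≈⟨ Lin-ext-All (evalMono σ) monomial evalMono-σ p′ (All-filterMonos VarsFrom varsFrom? p) ⟩
    Lin monomial p′                    ≈⟨ Lin-monomial p′ ⟩
    p′                                 ≈⟨ p′≋p ⟩
    p                                  ∎
    where
    open PolyReasoning n
    p′ : Poly n
    p′ = filterMonos VarsFrom varsFrom? p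
    p′≋p : p′ ≋ p
    p′≋p = filterMonos-≋ VarsFrom varsFrom? p p-vars

  σ-inject≤ : ∀ i → σ (inject≤ i M≤n) ≡ -P ℓ i
  σ-inject≤ i with σ-cases (inject≤ i M≤n)
  ... | inj₁ (j<M , e) =
    trans e (cong (-P_ ∘ ℓ) (FinP.toℕ-injective (trans (FinP.toℕ-fromℕ< j<M) (FinP.toℕ-inject≤ i M≤n))))
  ... | inj₂ (j≮M , _) = ⊥-elim (j≮M (Eq.subst (_< M) (sym (FinP.toℕ-inject≤ i M≤n)) (FinP.toℕ<n i)))

  subst-σ-generator : ∀ i → subst σ (generator i) ≋ []
  subst-σ-generator i = begin
    subst σ (X (inject≤ i M≤n) ++ ℓ i)               ≈⟨ Lin-++ (evalMono σ) (X (inject≤ i M≤n)) (ℓ i) ⟩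
    subst σ (X (inject≤ i M≤n)) ++ subst σ (ℓ i)     ≈⟨ +-cong (subst-X σ (inject≤ i M≤n)) (subst-σ-fixes (ℓ i) (oℓ i)) ⟩
    σ (inject≤ i M≤n) ++ ℓ i                         ≡⟨ cong (_++ ℓ i) (σ-inject≤ i) ⟩
    -P ℓ i ++ ℓ i                                    ≈⟨ neg-inverseˡ (ℓ i) ⟩
    []                                               ∎
    where open PolyReasoning n

  X-σ-InIdeal : ∀ j → InIdeal 0 (X j ++ -P σ j)
  X-σ-InIdeal j with σ-cases j
  ... | inj₁ (j<M , e) rewrite e =
    InIdeal-cong (+-cong (≡⇒≋ (cong X i↑≡j)) (≋-sym (neg-involutive (ℓ (fromℕ< j<M)))))
                 (InIdeal-generator (fromℕ< j<M))
    where
    i↑≡j : inject≤ (fromℕ< j<M) M≤n ≡ j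
    i↑≡j = FinP.toℕ-injective (trans (FinP.toℕ-inject≤ (fromℕ< j<M) M≤n) (FinP.toℕ-fromℕ< j<M))
    open PolySolver n
    neg-involutive : ∀ p → -P -P p ≋ p
    neg-involutive = solve 1 (λ p → :- (:- p) := p) ≋-refl
  ... | inj₂ (_ , e) rewrite e = InIdeal-≋[] 0 (≋-trans (+-comm (X j) (-P X j)) (neg-inverseˡ (X j)))

  HasDecomp-subst-σ : ∀ {k} f (v : Fin M → Poly n) (u w : Fin k → Poly n) →
    (∀ j → PosForm (u j)) → (∀ j → PosForm (w j)) →
    f ≋ sumP (λ i → generator i *P v i) ++ sumP (λ j → u j *P w j) →
    Σ ℕ λ b → b ≤ k × HasDecomp (subst σ f) b
  HasDecomp-subst-σ {k} f v u w pu pw f≋ =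
    let (b , b≤k , dec) = sumProducts-HasDecomp k (subst σ ∘ u) (subst σ ∘ w)
                            (λ j → subst-PosHomog (u j) (pu j)) (λ j → subst-PosHomog (w j) (pw j))
    in b , b≤k , HasDecomp-cong b (≋-sym σf≋) dec
    where
    subst-PosHomog : ∀ p → PosForm p → PosHomog (subst σ p)
    subst-PosHomog p (e , 1≤e , hp , _) = e , 1≤e , Homog-subst σ Homog-σ e p hp
    generators-vanish : subst σ (sumP (λ i → generator i *P v i)) ≋ []
    generators-vanish = ≋-trans (subst-sumP σ (λ i → generator i *P v i))
      (sumP-zero _ λ i → ≋-trans (subst-* σ (generator i) (v i)) (*-congˡ (subst σ (v i)) (subst-σ-generator i)))
    σf≋ : subst σ f ≋ sumP (λ j → subst σ (u j) *P subst σ (w j))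
    σf≋ = begin
      subst σ f
        ≈⟨ Lin-cong (evalMono σ) f≋ ⟩
      subst σ (sumP (λ i → generator i *P v i) ++ sumP (λ j → u j *P w j))
        ≈⟨ Lin-++ (evalMono σ) (sumP (λ i → generator i *P v i)) (sumP (λ j → u j *P w j)) ⟩
      subst σ (sumP (λ i → generator i *P v i)) ++ subst σ (sumP (λ j → u j *P w j))
        ≈⟨ +-cong generators-vanish
                  (≋-trans (subst-sumP σ (λ j → u j *P w j)) (sumP-cong λ j → subst-* σ (u j) (w j))) ⟩
      [] ++ sumP (λ j → subst σ (u j) *P subst σ (w j))
        ∎
      where open PolyReasoning n

  HasDecomp-sub-subst-σ : ∀ e f → Homog (suc (suc e)) f → Σ ℕ λ a → a ≤ M × HasDecomp (f ++ -P subst σ f) a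
  HasDecomp-sub-subst-σ e f hf = InIdeal⇒HasDecomp PosHomog-generator e (f ++ -P subst σ f)
    (sub-subst-InIdeal σ Homog-σ X-σ-InIdeal (suc e) f hf)
    where
    PosHomog-generator : ∀ i → PosHomog (generator i)
    PosHomog-generator i = 1 , s≤s z≤n , Supported-++ (X (inject≤ i M≤n)) (ℓ i) (Homog-X (inject≤ i M≤n)) (hℓ i)

lemma2p3 : (n : ℕ) (f : Poly n) (d : ℕ) → 2 ≤ d → Homog d f → NonZeroP f →
    (h : ℕ) → HInv f h →
    (M : ℕ) → 1 ≤ M → M ≤ h → (M≤n : M ≤ n) →
    (ℓ : Fin M → Poly n) → (∀ i → Homog 1 (ℓ i)) → (∀ i → OnlyVarsFrom M (ℓ i)) →
    (v : Fin M → Poly n) → (∀ i → PosForm (v i)) →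
    (u w : Fin (h ∸ M) → Poly n) → (∀ j → PosForm (u j)) → (∀ j → PosForm (w j)) →
    f ≈ sumP (λ i → (X (inject≤ i M≤n) +P ℓ i) *P v i) +P sumP (λ j → u j *P w j) →
    (g : Poly n) → f ≈ g +P subst (σℓ M≤n ℓ) f →
    (∀ k → k < M → ¬ HasDecomp g k) × HInv (subst (σℓ M≤n ℓ) f) (h ∸ M)
lemma2p3 n f (suc (suc e)) (s≤s (s≤s z≤n)) hf _ h (_ , h-minimal) M _ M≤h M≤n ℓ hℓ oℓ v _ u w pu pw f≈ g f≈g+σf =
  (λ k k<M gk → ℕP.<⇒≱ k<M (M≤ gk)) ,
  Eq.subst (HasDecomp σf) (ℕP.≤-antisym b≤h∸M (h∸M≤ σf-dec)) σf-dec ,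
  (λ k k<h∸M σfk → ℕP.<⇒≱ k<h∸M (h∸M≤ σfk))
  where
  open Elimination M≤n ℓ hℓ oℓ
  σf : Poly n
  σf = subst σ f

  f≋g+σf : f ≋ g ++ σf
  f≋g+σf = ≈⇒≋ f (g ++ σf) f≈g+σf

  σf-bound : Σ ℕ λ b → b ≤ h ∸ M × HasDecomp σf b
  σf-bound = HasDecomp-subst-σ f v u w pu pw (≈⇒≋ f _ f≈)

  b : ℕ
  b = proj₁ σf-bound

  b≤h∸M : b ≤ h ∸ M
  b≤h∸M = proj₁ (proj₂ σf-bound)

  σf-dec : HasDecomp σf b
  σf-dec = proj₂ (proj₂ σf-bound)

  g≋f-σf : g ≋ f ++ -P σf
  g≋f-σf = ≋-trans (solve 2 (λ g σf → g := (g :+ σf) :- σf) ≋-refl g σf) (+-congˡ (-P σf) (≋-sym f≋g+σf))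
    where open PolySolver n
  g-bound : Σ ℕ λ a → a ≤ M × HasDecomp (f ++ -P σf) a
  g-bound = HasDecomp-sub-subst-σ e f hf

  a : ℕ
  a = proj₁ g-bound

  a≤M : a ≤ M
  a≤M = proj₁ (proj₂ g-bound)

  g-dec : HasDecomp g a
  g-dec = HasDecomp-cong a (≋-sym g≋f-σf) (proj₂ (proj₂ g-bound))

  h≤ : ∀ {a b} → HasDecomp g a → HasDecomp σf b → h ≤ a ℕ.+ b
  h≤ = h-subadditive {g₁ = g} {g₂ = σf} h-minimal f≋g+σf

  M≤ : ∀ {k} → HasDecomp g k → M ≤ k
  M≤ {k} gk = ℕP.+-cancelʳ-≤ (h ∸ M) M k (begin
    M ℕ.+ (h ∸ M) ≡⟨ ℕP.m+[n∸m]≡n M≤h ⟩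
    h             ≤⟨ h≤ gk σf-dec ⟩
    k ℕ.+ b       ≤⟨ ℕP.+-monoʳ-≤ k b≤h∸M ⟩
    k ℕ.+ (h ∸ M) ∎)
    where open ℕP.≤-Reasoning

  h∸M≤ : ∀ {k} → HasDecomp σf k → h ∸ M ≤ k
  h∸M≤ {k} σfk = ℕP.m≤n+o⇒m∸n≤o h M (ℕP.≤-trans (h≤ g-dec σfk) (ℕP.+-monoˡ-≤ k a≤M))
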